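{- Suppose $\Gamma,\Gamma'\ \mathsf{wf}$ and $\mathrm{dom}(\Gamma')\cap\mathrm{dom}(\Delta)=\emptyset$. (1) If $\Gamma,\Delta\vdash M:A$ then $\Gamma,\Gamma',\Delta\vdash M:A$. (2) If $\Gamma,\Delta;B\vdash l:C$ then $\Gamma,\Gamma',\Delta;B\vdash l:C$. (3) If $\Gamma,\Delta\ \mathsf{wf}$ then $\Gamma,\Gamma',\Delta\ \mathsf{wf}$.
   Context: Ground PTSC syntax: given sorts $\mathcal S$ and variables, terms $M ::= \Pi x^{A}.B \mid \lambda x^{A}.M \mid s \mid x\,l \mid M\,l \mid \langle N/x\rangle_A M$ and lists $l ::= [\,] \mid M\cdot l \mid l @ l' \mid \langle N/x\rangle_A l$ ($\langle N/x\rangle_A$ explicit substitution binding $x$; $\Pi,\lambda$ bind $x$; up to $\alpha$-conversion). Reduction $\to$ is the contextual closure of: $(\lambda x^A.M)(N\cdot l)\to(\langle N/x\rangle_A M)\,l$; $M\,[\,]\to M$; $(x\,l)\,l'\to x\,(l@l')$; $(M\,l)\,l'\to M\,(l@l')$; $(M\cdot l')@l\to M\cdot(l'@l)$; $[\,]@l\to l$; $(l@l')@l''\to l@(l'@l'')$; $l@[\,]\to l$; $\langle P/y\rangle_G(\lambda x^A.M)\to\lambda x^{\langle P/y\rangle_G A}.\langle P/y\rangle_G M$; $\langle P/y\rangle_G(y\,l)\to P\,(\langle P/y\rangle_G l)$; $\langle P/y\rangle_G(x\,l)\to x\,(\langle P/y\rangle_G l)$ ($x\ne y$); $\langle P/y\rangle_G(M\,l)\to(\langle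 P/y\rangle_G M)(\langle P/y\rangle_G l)$; $\langle P/y\rangle_G(\Pi x^A.B)\to\Pi x^{\langle P/y\rangle_G A}.\langle P/y\rangle_G B$; $\langle P/y\rangle_G s\to s$; $\langle P/y\rangle_G[\,]\to[\,]$; $\langle P/y\rangle_G(M\cdot l)\to(\langle P/y\rangle_G M)\cdot(\langle P/y\rangle_G l)$; $\langle P/y\rangle_G(l@l')\to(\langle P/y\rangle_G l)@(\langle P/y\rangle_G l')$. $\leftrightarrow^*$ is the induced equivalence. A PTSC is given by $\mathcal A\subseteq\mathcal S^2$, $\mathcal R\subseteq\mathcal S^3$. An environment is a list of declarations $(x:A)$; $\mathrm{dom}$ is the list of declared variables; $\langle P/x\rangle_A\Delta$ applies $\langle P/x\rangle_A$ to every type in $\Delta$; $\Gamma\sqsubseteq\Delta$ means for each $(x:A)\in\Gamma$ there is $(x:B)\in\Delta$ with $A\leftrightarrow^*B$. Judgements $\Gamma\ \mathsf{wf}$, $\Gamma\vdash M:A$, $\Gamma;B\vdash l:C$ are derived by: (empty) $\emptyset\ \mathsf{wf}$; (extend) $\Gamma\vdash A:s$, $x\notin\mathrm{dom}\,\Gamma$ $\Rightarrow$ $\Gamma,(x:A)\ \mathsf{wf}$; (sorted) $\Gamma\ \mathsf{wf}$, $(s,s')\in\mathcal A$ $\Rightarrow$ $\Gamma\vdash s:s'$; ($\Pi$wf) $\Gamma\vdash A:s_1$, $\Gamma,(x:A)\vdash B:s_2$, $(s_1,s_2,s_3)\in\mathcal R$ $\Rightarrow$ $\Gamma\vdash\Pi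 x^A.B:s_3$; ($\Pi$R) $\Gamma\vdash\Pi x^A.B:s$, $\Gamma,(x:A)\vdash M:B$ $\Rightarrow$ $\Gamma\vdash\lambda x^A.M:\Pi x^A.B$; (select) $\Gamma;A\vdash l:B$, $(x:A)\in\Gamma$ $\Rightarrow$ $\Gamma\vdash x\,l:B$; (axiom) $\Gamma\vdash A:s$ $\Rightarrow$ $\Gamma;A\vdash[\,]:A$; (conv$_R$) $\Gamma\vdash M:A$, $\Gamma\vdash B:s$, $A\leftrightarrow^*B$ $\Rightarrow$ $\Gamma\vdash M:B$; ($\Pi$L) $\Gamma\vdash\Pi x^A.B:s$, $\Gamma\vdash M:A$, $\Gamma;\langle M/x\rangle_A B\vdash l:C$ $\Rightarrow$ $\Gamma;\Pi x^A.B\vdash M\cdot l:C$; (conv$'_R$) $\Gamma;C\vdash l:A$, $\Gamma\vdash B:s$, $A\leftrightarrow^*B$ $\Rightarrow$ $\Gamma;C\vdash l:B$; (conv$_L$) $\Gamma;A\vdash l:C$, $\Gamma\vdash B:s$, $A\leftrightarrow^*B$ $\Rightarrow$ $\Gamma;B\vdash l:C$; (Cut$_1$) $\Gamma;C\vdash l':A$, $\Gamma;A\vdash l:B$ $\Rightarrow$ $\Gamma;C\vdash l'@l:B$; (Cut$_2$) $\Gamma\vdash P:A$, $\Gamma,(x:A),\Delta;B\vdash l:C$, $\Gamma,\langle P/x\rangle_A\Delta\sqsubseteq\Delta'$, $\Delta'\ \mathsf{wf}$ $\Rightarrow$ $\Delta';\langle P/x\rangle_A B\vdash\langle P/x\rangle_A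 l:\langle P/x\rangle_A C$; (Cut$_3$) $\Gamma\vdash M:A$, $\Gamma;A\vdash l:B$ $\Rightarrow$ $\Gamma\vdash M\,l:B$; (Cut$_4$) $\Gamma\vdash P:A$, $\Gamma,(x:A),\Delta\vdash M:C$, $\Gamma,\langle P/x\rangle_A\Delta\sqsubseteq\Delta'$, $\Delta'\ \mathsf{wf}$ $\Rightarrow$ $\Delta'\vdash\langle P/x\rangle_A M:C'$, where $C'=C$ if $C\in\mathcal S$ and $C'=\langle P/x\rangle_A C$ otherwise. In all rules $s,s',s_i\in\mathcal S$. -}

module Defs where

open import Data.Nat using (ℕ; zero; suc; _≡ᵇ_; _<ᵇ_; _∸_)
open import Data.Bool using (Bool; true; false; if_then_else_)
open import Data.List using (List; []; _∷_; _++_; map; [_])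
open import Data.List.Membership.Propositional using (_∈_; _∉_)
open import Data.Product using (_×_; _,_; proj₁; proj₂; ∃)

Name : Set
Name = ℕ

-- Syntax (locally nameless: free variables are names, bound variables
-- are de Bruijn indices, so alpha-equivalent terms are syntactically equal).

module Syntax (S : Set) where

  mutual
    data Term : Set where
      pi   : Term → Term → Term          -- Π x^A . B        (B under binder)
      lam  : Term → Term → Term          -- λ x^A . M        (M under binder)
      srt  : S → Term
      fvar : Name → Lst → Term
      bvar : ℕ → Lst → Term
      app  : Term → Lst → Term
      es   : Term → Term → Term → Term   -- es N A M = ⟨N/x⟩_A M  (M under binder)

    data Lst : Set where
      nil  : Lst
      cons : Term → Lst → Lst
      cat  : Lst → Lst → Lst
      esl  : Term → Term → Lst → Lst     -- esl N A l = ⟨N/x⟩_A l  (l under binder)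

  mutual
    shift : ℕ → Term → Term
    shift c (pi A B)   = pi (shift c A) (shift (suc c) B)
    shift c (lam A M)  = lam (shift c A) (shift (suc c) M)
    shift c (srt s)    = srt s
    shift c (fvar x l) = fvar x (shiftL c l)
    shift c (bvar i l) = bvar (if i <ᵇ c then i else suc i) (shiftL c l)
    shift c (app M l)  = app (shift c M) (shiftL c l)
    shift c (es N A M) = es (shift c N) (shift c A) (shift (suc c) M)

    shiftL : ℕ → Lst → Lst
    shiftL c nil         = nil
    shiftL c (cons M l)  = cons (shift c M) (shiftL c l)
    shiftL c (cat l l')  = cat (shiftL c l) (shiftL c l')
    shiftL c (esl N A l) = esl (shift c N) (shift c A) (shiftL (suc c) l)

  swapIx : ℕ → ℕ → ℕ
  swapIx k i = if i ≡ᵇ k then suc k else (if i ≡ᵇ suc k then k else i)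

  mutual
    swap : ℕ → Term → Term
    swap k (pi A B)   = pi (swap k A) (swap (suc k) B)
    swap k (lam A M)  = lam (swap k A) (swap (suc k) M)
    swap k (srt s)    = srt s
    swap k (fvar x l) = fvar x (swapL k l)
    swap k (bvar i l) = bvar (swapIx k i) (swapL k l)
    swap k (app M l)  = app (swap k M) (swapL k l)
    swap k (es N A M) = es (swap k N) (swap k A) (swap (suc k) M)

    swapL : ℕ → Lst → Lst
    swapL k nil         = nil
    swapL k (cons M l)  = cons (swap k M) (swapL k l)
    swapL k (cat l l')  = cat (swapL k l) (swapL k l')
    swapL k (esl N A l) = esl (swap k N) (swap k A) (swapL (suc k) l)

  mutual
    openT : ℕ → Name → Term → Term
    openT k x (pi A B)   = pi (openT k x A) (openT (suc k) x B)
    openT k x (lam A M)  = lam (openT k x A) (openT (suc k) x M)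
    openT k x (srt s)    = srt s
    openT k x (fvar y l) = fvar y (openL k x l)
    openT k x (bvar i l) =
      if i ≡ᵇ k then fvar x (openL k x l)
      else (if k <ᵇ i then bvar (i ∸ 1) (openL k x l) else bvar i (openL k x l))
    openT k x (app M l)  = app (openT k x M) (openL k x l)
    openT k x (es N A M) = es (openT k x N) (openT k x A) (openT (suc k) x M)

    openL : ℕ → Name → Lst → Lst
    openL k x nil         = nil
    openL k x (cons M l)  = cons (openT k x M) (openL k x l)
    openL k x (cat l l')  = cat (openL k x l) (openL k x l')
    openL k x (esl N A l) = esl (openT k x N) (openT k x A) (openL (suc k) x l)

  mutual
    closeT : ℕ → Name → Term → Term
    closeT k x (pi A B)   = pi (closeT k x A) (closeT (suc k) x B)
    closeT k x (lam A M)  = lam (closeT k x A) (closeT (suc k) x M)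
    closeT k x (srt s)    = srt s
    closeT k x (fvar y l) =
      if y ≡ᵇ x then bvar k (closeL k x l) else fvar y (closeL k x l)
    closeT k x (bvar i l) = bvar (if i <ᵇ k then i else suc i) (closeL k x l)
    closeT k x (app M l)  = app (closeT k x M) (closeL k x l)
    closeT k x (es N A M) = es (closeT k x N) (closeT k x A) (closeT (suc k) x M)

    closeL : ℕ → Name → Lst → Lst
    closeL k x nil         = nil
    closeL k x (cons M l)  = cons (closeT k x M) (closeL k x l)
    closeL k x (cat l l')  = cat (closeL k x l) (closeL k x l')
    closeL k x (esl N A l) = esl (closeT k x N) (closeT k x A) (closeL (suc k) x l)

  -- the named explicit substitution ⟨P/x⟩_A applied to a term / list
  sub : Term → Term → Name → Term → Term
  sub P A x M = es P A (closeT 0 x M)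

  subL : Term → Term → Name → Lst → Lst
  subL P A x l = esl P A (closeL 0 x l)

  -- C' of rule Cut4: C if C is a sort, ⟨P/x⟩_A C otherwise
  subC : Term → Term → Name → Term → Term
  subC P A x (srt s)    = srt s
  subC P A x (pi B C)   = sub P A x (pi B C)
  subC P A x (lam B C)  = sub P A x (lam B C)
  subC P A x (fvar y l) = sub P A x (fvar y l)
  subC P A x (bvar i l) = sub P A x (bvar i l)
  subC P A x (app C l)  = sub P A x (app C l)
  subC P A x (es N B C) = sub P A x (es N B C)

  infix 4 _⟶_ _⟶L_ _↔*_

  mutual
    data _⟶_ : Term → Term → Set where
      β        : ∀ {A M N l} → app (lam A M) (cons N l) ⟶ app (es N A M) l
      app-nil  : ∀ {M} → app M nil ⟶ M
      fvar-app : ∀ {x l l'} → app (fvar x l) l' ⟶ fvar x (cat l l')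
      bvar-app : ∀ {i l l'} → app (bvar i l) l' ⟶ bvar i (cat l l')
      app-app  : ∀ {M l l'} → app (app M l) l' ⟶ app M (cat l l')
      es-lam   : ∀ {P G A M} →
                 es P G (lam A M) ⟶ lam (es P G A) (es (shift 0 P) (shift 0 G) (swap 0 M))
      es-var   : ∀ {P G l} → es P G (bvar 0 l) ⟶ app P (esl P G l)
      es-bvar  : ∀ {P G i l} → es P G (bvar (suc i) l) ⟶ bvar i (esl P G l)
      es-fvar  : ∀ {P G x l} → es P G (fvar x l) ⟶ fvar x (esl P G l)
      es-app   : ∀ {P G M l} → es P G (app M l) ⟶ app (es P G M) (esl P G l)
      es-pi    : ∀ {P G A B} →
                 es P G (pi A B) ⟶ pi (es P G A) (es (shift 0 P) (shift 0 G) (swap 0 B))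
      es-srt   : ∀ {P G s} → es P G (srt s) ⟶ srt s
      pi₁  : ∀ {A A' B} → A ⟶ A' → pi A B ⟶ pi A' B
      pi₂  : ∀ {A B B'} → B ⟶ B' → pi A B ⟶ pi A B'
      lam₁ : ∀ {A A' M} → A ⟶ A' → lam A M ⟶ lam A' M
      lam₂ : ∀ {A M M'} → M ⟶ M' → lam A M ⟶ lam A M'
      fvar₁ : ∀ {x l l'} → l ⟶L l' → fvar x l ⟶ fvar x l'
      bvar₁ : ∀ {i l l'} → l ⟶L l' → bvar i l ⟶ bvar i l'
      app₁ : ∀ {M M' l} → M ⟶ M' → app M l ⟶ app M' l
      app₂ : ∀ {M l l'} → l ⟶L l' → app M l ⟶ app M l'
      es₁  : ∀ {N N' A M} → N ⟶ N' → es N A M ⟶ es N' A M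
      es₂  : ∀ {N A A' M} → A ⟶ A' → es N A M ⟶ es N A' M
      es₃  : ∀ {N A M M'} → M ⟶ M' → es N A M ⟶ es N A M'

    data _⟶L_ : Lst → Lst → Set where
      cons-cat : ∀ {M l' l} → cat (cons M l') l ⟶L cons M (cat l' l)
      nil-cat  : ∀ {l} → cat nil l ⟶L l
      cat-cat  : ∀ {l l' l''} → cat (cat l l') l'' ⟶L cat l (cat l' l'')
      cat-nil  : ∀ {l} → cat l nil ⟶L l
      esl-nil  : ∀ {P G} → esl P G nil ⟶L nil
      esl-cons : ∀ {P G M l} → esl P G (cons M l) ⟶L cons (es P G M) (esl P G l)
      esl-cat  : ∀ {P G l l'} → esl P G (cat l l') ⟶L cat (esl P G l) (esl P G l')
      cons₁ : ∀ {M M' l} → M ⟶ M' → cons M l ⟶L cons M' l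
      cons₂ : ∀ {M l l'} → l ⟶L l' → cons M l ⟶L cons M l'
      cat₁  : ∀ {l₁ l₁' l₂} → l₁ ⟶L l₁' → cat l₁ l₂ ⟶L cat l₁' l₂
      cat₂  : ∀ {l₁ l₂ l₂'} → l₂ ⟶L l₂' → cat l₁ l₂ ⟶L cat l₁ l₂'
      esl₁  : ∀ {N N' A l} → N ⟶ N' → esl N A l ⟶L esl N' A l
      esl₂  : ∀ {N A A' l} → A ⟶ A' → esl N A l ⟶L esl N A' l
      esl₃  : ∀ {N A l l'} → l ⟶L l' → esl N A l ⟶L esl N A l'

  data _↔*_ : Term → Term → Set where
    ↔-step  : ∀ {M N} → M ⟶ N → M ↔* N
    ↔-refl  : ∀ {M} → M ↔* M
    ↔-sym   : ∀ {M N} → M ↔* N → N ↔* M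
    ↔-trans : ∀ {M N P} → M ↔* N → N ↔* P → M ↔* P

  -- Environments: lists of declarations (x : A), leftmost = oldest

  Env : Set
  Env = List (Name × Term)

  dom : Env → List Name
  dom = map proj₁

  _,,_∶_ : Env → Name → Term → Env
  Γ ,, x ∶ A = Γ ++ [ (x , A) ]

  subEnv : Term → Term → Name → Env → Env
  subEnv P A x = map (λ d → (proj₁ d , sub P A x (proj₂ d)))

  _⊑_ : Env → Env → Set
  Γ ⊑ Δ = ∀ {x A} → (x , A) ∈ Γ → ∃ λ B → (x , B) ∈ Δ × A ↔* B

module PTSC (S : Set) (Ax : S → S → Set) (Rl : S → S → S → Set) where

  open Syntax S public

  mutual
    data WF : Env → Set where
      wf-empty  : WF []
      wf-extend : ∀ {Γ x A s} → Ty Γ A (srt s) → x ∉ dom Γ → WF (Γ ,, x ∶ A)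

    data Ty : Env → Term → Term → Set where
      sorted : ∀ {Γ s s'} → WF Γ → Ax s s' → Ty Γ (srt s) (srt s')
      Πwf    : ∀ {Γ A B s₁ s₂ s₃} → Ty Γ A (srt s₁) →
               (L : List Name) →
               (∀ x → x ∉ L → Ty (Γ ,, x ∶ A) (openT 0 x B) (srt s₂)) →
               Rl s₁ s₂ s₃ → Ty Γ (pi A B) (srt s₃)
      ΠR     : ∀ {Γ A B M s} → Ty Γ (pi A B) (srt s) →
               (L : List Name) →
               (∀ x → x ∉ L → Ty (Γ ,, x ∶ A) (openT 0 x M) (openT 0 x B)) →
               Ty Γ (lam A M) (pi A B)
      select : ∀ {Γ A B x l} → TyL Γ A l B → (x , A) ∈ Γ → Ty Γ (fvar x l) B
      convR  : ∀ {Γ M A B s} → Ty Γ M A → Ty Γ B (srt s) → A ↔* B → Ty Γ M B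
      Cut₃   : ∀ {Γ M A l B} → Ty Γ M A → TyL Γ A l B → Ty Γ (app M l) B
      Cut₄   : ∀ {Γ Δ Δ' P A x M C} → Ty Γ P A → Ty ((Γ ,, x ∶ A) ++ Δ) M C →
               (Γ ++ subEnv P A x Δ) ⊑ Δ' → WF Δ' →
               Ty Δ' (sub P A x M) (subC P A x C)

    data TyL : Env → Term → Lst → Term → Set where
      axiom  : ∀ {Γ A s} → Ty Γ A (srt s) → TyL Γ A nil A
      ΠL     : ∀ {Γ A B s M l C} → Ty Γ (pi A B) (srt s) → Ty Γ M A →
               TyL Γ (es M A B) l C → TyL Γ (pi A B) (cons M l) C
      convR' : ∀ {Γ C l A B s} → TyL Γ C l A → Ty Γ B (srt s) → A ↔* B → TyL Γ C l B
      convL  : ∀ {Γ A l C B s} → TyL Γ A l C → Ty Γ B (srt s) → A ↔* B → TyL Γ B l C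
      Cut₁   : ∀ {Γ C l' A l B} → TyL Γ C l' A → TyL Γ A l B → TyL Γ C (cat l' l) B
      Cut₂   : ∀ {Γ Δ Δ' P A x B l C} → Ty Γ P A → TyL ((Γ ,, x ∶ A) ++ Δ) B l C →
               (Γ ++ subEnv P A x Δ) ⊑ Δ' → WF Δ' →
               TyL Δ' (sub P A x B) (subL P A x l) (sub P A x C)

{-# OPTIONS --safe #-}
module Submission where

-- In the binder rules Πwf and ΠR the cofinite
-- quantification lets us demand that the new name also avoids dom Γ', and the
-- cut rules Cut₂ and Cut₄ conclude in an arbitrary context Δ', so for them only
-- the premises Γ ++ ⟨P/x⟩Δ ⊑ Δ' and Δ' wf have to be transported.

open import Defs
open import Data.List using ([]; _∷_; _++_)
open import Data.List.Properties using (++-assoc; ++-identityʳ; ++-conicalʳ; ∷ʳ-injective; ∷ʳ-++; map-++)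
open import Data.List.Membership.Propositional using (_∈_; _∉_)
open import Data.List.Membership.Propositional.Properties using (∈-++⁻; ∈-++⁺ˡ; ∈-++⁺ʳ)
open import Data.List.Relation.Binary.Subset.Propositional using (_⊆_)
open import Data.List.Relation.Binary.Subset.Propositional.Properties using (xs⊆xs++ys; xs⊆ys++xs; ++⁺ˡ; map⁺)
open import Data.List.Relation.Binary.Disjoint.Propositional using (Disjoint)
open import Data.List.Relation.Unary.Any using (here; there)
open import Data.Product using (_×_; _,_; proj₁; ∃-syntax; map₂)
open import Data.Sum using (_⊎_; inj₁; inj₂; [_,_])
open import Function using (_∘_)
open import Relation.Binary.PropositionalEquality using (_≡_; refl; sym; subst; subst₂)

module Weakening (S : Set) (Ax : S → S → Set) (Rl : S → S → S → Set) where
  open PTSC S Ax Rl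

  ∈-dom-++⁻ : ∀ E {F x} → x ∈ dom (E ++ F) → x ∈ dom E ⊎ x ∈ dom F
  ∈-dom-++⁻ E {F} = ∈-++⁻ (dom E) ∘ subst (_ ∈_) (map-++ proj₁ E F)

  ⊑-⊆-trans : ∀ {Γ E E'} → Γ ⊑ E → E ⊆ E' → Γ ⊑ E'
  ⊑-⊆-trans Γ⊑E E⊆E' x∈Γ with Γ⊑E x∈Γ
  ... | B , x∈E , A↔B = B , E⊆E' x∈E , A↔B

  -- Insertion Γ' E E' : E' is E with the well-formed block Γ' inserted at some
  -- position, the declarations after it being fresh for Γ'.
  data Insertion (Γ' : Env) : Env → Env → Set where
    base   : ∀ {Γ} → WF (Γ ++ Γ') → Insertion Γ' Γ (Γ ++ Γ')
    extend : ∀ {E E' x A} → Insertion Γ' E E' → x ∉ dom Γ' →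
             Insertion Γ' (E ,, x ∶ A) (E' ,, x ∶ A)

  module _ {Γ' : Env} where

    insertion⇒⊆ : ∀ {E E'} → Insertion Γ' E E' → E ⊆ E'
    insertion⇒⊆ (base {Γ} _) = xs⊆xs++ys Γ Γ'
    insertion⇒⊆ (extend ι _) = ++⁺ˡ _ (insertion⇒⊆ ι)

    ∉-insertion : ∀ {E E' x} → Insertion Γ' E E' → x ∉ dom E → x ∉ dom Γ' → x ∉ dom E'
    ∉-insertion (base {Γ} _) x∉Γ x∉Γ' = [ x∉Γ , x∉Γ' ] ∘ ∈-dom-++⁻ Γ
    ∉-insertion (extend {E} {E'} ι _) x∉E,y x∉Γ' =
      [ ∉-insertion ι (x∉E,y ∘ map⁺ proj₁ (xs⊆xs++ys E _)) x∉Γ'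
      , x∉E,y ∘ map⁺ proj₁ (xs⊆ys++xs _ E)
      ] ∘ ∈-dom-++⁻ E'

    insertion-[]⁻ : ∀ {E E'} → Insertion Γ' E E' → E ≡ [] → WF E'
    insertion-[]⁻ (base wf) _ = wf
    insertion-[]⁻ (extend {E} _ _) eq with () ← ++-conicalʳ E _ eq

    insertion-∷ʳ⁻ : ∀ {E E' E₀ x A} → Insertion Γ' E E' → E ≡ E₀ ,, x ∶ A →
                    WF E' ⊎ ∃[ E₀' ] (Insertion Γ' E₀ E₀' × x ∉ dom Γ' × E' ≡ E₀' ,, x ∶ A)
    insertion-∷ʳ⁻ (base wf) _ = inj₁ wf
    insertion-∷ʳ⁻ (extend ι x∉Γ') eq with refl , refl ← ∷ʳ-injective _ _ eq =
      inj₂ (_ , ι , x∉Γ' , refl)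

    insertion-++ : ∀ {E E' Δ} → Insertion Γ' E E' → Disjoint (dom Γ') (dom Δ) →
                   Insertion Γ' (E ++ Δ) (E' ++ Δ)
    insertion-++ {Δ = []} ι _ =
      subst₂ (Insertion Γ') (sym (++-identityʳ _)) (sym (++-identityʳ _)) ι
    insertion-++ {E} {E'} {d ∷ Δ} ι disjoint =
      subst₂ (Insertion Γ') (∷ʳ-++ E d Δ) (∷ʳ-++ E' d Δ)
        (insertion-++ (extend ι (λ x∈Γ' → disjoint (x∈Γ' , here refl))) (disjoint ∘ map₂ there))

    mutual
      wkTy : ∀ {E E' M A} → Insertion Γ' E E' → Ty E M A → Ty E' M A
      wkTy ι (sorted wf a)       = sorted (wkWF ι wf) a
      wkTy ι (Πwf tA L tB r)     =
        Πwf (wkTy ι tA) (L ++ dom Γ')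
          (λ x x∉ → wkTy (extend ι (x∉ ∘ ∈-++⁺ʳ L)) (tB x (x∉ ∘ ∈-++⁺ˡ))) r
      wkTy ι (ΠR tΠ L tM)        =
        ΠR (wkTy ι tΠ) (L ++ dom Γ')
          (λ x x∉ → wkTy (extend ι (x∉ ∘ ∈-++⁺ʳ L)) (tM x (x∉ ∘ ∈-++⁺ˡ)))
      wkTy ι (select tl x∈)      = select (wkTyL ι tl) (insertion⇒⊆ ι x∈)
      wkTy ι (convR tM tB A↔B)   = convR (wkTy ι tM) (wkTy ι tB) A↔B
      wkTy ι (Cut₃ tM tl)        = Cut₃ (wkTy ι tM) (wkTyL ι tl)
      wkTy ι (Cut₄ tP tM ⊑E wf)  = Cut₄ tP tM (⊑-⊆-trans ⊑E (insertion⇒⊆ ι)) (wkWF ι wf)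

      wkTyL : ∀ {E E' B l C} → Insertion Γ' E E' → TyL E B l C → TyL E' B l C
      wkTyL ι (axiom tA)          = axiom (wkTy ι tA)
      wkTyL ι (ΠL tΠ tM tl)       = ΠL (wkTy ι tΠ) (wkTy ι tM) (wkTyL ι tl)
      wkTyL ι (convR' tl tB A↔B)  = convR' (wkTyL ι tl) (wkTy ι tB) A↔B
      wkTyL ι (convL tl tB A↔B)   = convL (wkTyL ι tl) (wkTy ι tB) A↔B
      wkTyL ι (Cut₁ tl' tl)       = Cut₁ (wkTyL ι tl') (wkTyL ι tl)
      wkTyL ι (Cut₂ tP tl ⊑E wf)  = Cut₂ tP tl (⊑-⊆-trans ⊑E (insertion⇒⊆ ι)) (wkWF ι wf)

      wkWF : ∀ {E E'} → Insertion Γ' E E' → WF E → WF E'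
      wkWF ι wf-empty = insertion-[]⁻ ι refl
      wkWF ι (wf-extend tA x∉E) with insertion-∷ʳ⁻ ι refl
      ... | inj₁ wf                     = wf
      ... | inj₂ (_ , ι₀ , x∉Γ' , refl) = wf-extend (wkTy ι₀ tA) (∉-insertion ι₀ x∉E x∉Γ')

lemma3p5 : (S : Set) (Ax : S → S → Set) (Rl : S → S → S → Set) →
    let open PTSC S Ax Rl in
    (Γ Γ' Δ : Env) → WF (Γ ++ Γ') → Disjoint (dom Γ') (dom Δ) →
      ((∀ {M A} → Ty (Γ ++ Δ) M A → Ty (Γ ++ Γ' ++ Δ) M A)
      × (∀ {B l C} → TyL (Γ ++ Δ) B l C → TyL (Γ ++ Γ' ++ Δ) B l C)
      × (WF (Γ ++ Δ) → WF (Γ ++ Γ' ++ Δ)))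
lemma3p5 S Ax Rl Γ Γ' Δ wfΓΓ' disjoint = wkTy ι , wkTyL ι , wkWF ι
  where
  open Weakening S Ax Rl

  ι : Insertion Γ' (Γ ++ Δ) (Γ ++ Γ' ++ Δ)
  ι = subst (Insertion Γ' (Γ ++ Δ)) (++-assoc Γ Γ' Δ) (insertion-++ (base wfΓΓ') disjoint)
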